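{- Let $R$ be a dark equivalence relation on $\omega$ that has at least one computable equivalence class. Then $R$ is not finitely minimal.
   Context: For equivalence relations $R,S$ on $\omega$, $R\leq_c S$ if there is a total computable $f$ with $x\mathrel{R}y\Leftrightarrow f(x)\mathrel{S}f(y)$ for all $x,y$; $R<_c S$ means $R\leq_c S$ and $S\not\leq_c R$. $\mathrm{Id}$ is the identity relation on $\omega$. $R$ is light if $\mathrm{Id}\leq_c R$; $R$ is dark if it is not light and has infinitely many equivalence classes. $R$ is finitely minimal if every equivalence relation $S$ with $S<_c R$ has only finitely many equivalence classes. -}

module Defs where

open import Data.Nat using (ℕ; zero; suc; _<_)
open import Data.Fin using (Fin)
open import Data.Vec using (Vec; []; _∷_; lookup)
open import Data.Product using (Σ; ∃; ∃-syntax; _×_; _,_)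
open import Relation.Nullary using (¬_)
open import Relation.Binary.PropositionalEquality using (_≡_)
open import Relation.Binary.Structures using (IsEquivalence)

data PR : ℕ → Set where
  zer  : ∀ {n} → PR n
  succ : PR 1
  proj : ∀ {n} → Fin n → PR n
  comp : ∀ {m n} → PR m → Vec (PR n) m → PR n
  prec : ∀ {n} → PR n → PR (suc (suc n)) → PR (suc n)
  mu   : ∀ {n} → PR (suc n) → PR n

mutual
  data _[_]↓_ : ∀ {n} → PR n → Vec ℕ n → ℕ → Set where
    zer↓  : ∀ {n} {xs : Vec ℕ n} → zer [ xs ]↓ 0
    succ↓ : ∀ {x} → succ [ x ∷ [] ]↓ suc x
    proj↓ : ∀ {n} {i : Fin n} {xs} → proj i [ xs ]↓ lookup xs i
    comp↓ : ∀ {m n} {f : PR m} {gs : Vec (PR n) m} {xs ys y}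
            → gs [ xs ]↓* ys → f [ ys ]↓ y → comp f gs [ xs ]↓ y
    prec0 : ∀ {n} {g : PR n} {h : PR (suc (suc n))} {xs y}
            → g [ xs ]↓ y → prec g h [ 0 ∷ xs ]↓ y
    precS : ∀ {n} {g : PR n} {h : PR (suc (suc n))} {k xs r y}
            → prec g h [ k ∷ xs ]↓ r → h [ k ∷ r ∷ xs ]↓ y
            → prec g h [ suc k ∷ xs ]↓ y
    mu↓   : ∀ {n} {f : PR (suc n)} {xs y}
            → f [ y ∷ xs ]↓ 0
            → (∀ z → z < y → ∃[ k ] (f [ z ∷ xs ]↓ suc k))
            → mu f [ xs ]↓ y

  data _[_]↓*_ : ∀ {m n} → Vec (PR n) m → Vec ℕ n → Vec ℕ m → Set where
    []↓ : ∀ {n} {xs : Vec ℕ n} → [] [ xs ]↓* []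
    ∷↓  : ∀ {m n} {g : PR n} {gs : Vec (PR n) m} {xs y ys}
          → g [ xs ]↓ y → gs [ xs ]↓* ys → (g ∷ gs) [ xs ]↓* (y ∷ ys)

Computable : (ℕ → ℕ) → Set
Computable f = Σ (PR 1) λ p → ∀ x → p [ x ∷ [] ]↓ f x

record EqRel : Set₁ where
  field
    rel   : ℕ → ℕ → Set
    isEq  : IsEquivalence rel
open EqRel public

_≤c_ : EqRel → EqRel → Set
R ≤c S = Σ (ℕ → ℕ) λ f → Computable f ×
           (∀ x y → (rel R x y → rel S (f x) (f y)) × (rel S (f x) (f y) → rel R x y))

_<c_ : EqRel → EqRel → Set
R <c S = R ≤c S × ¬ (S ≤c R)

IdRel : EqRel
IdRel = record { rel = _≡_ ; isEq = record { refl = Relation.Binary.PropositionalEquality.refl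
                                            ; sym = Relation.Binary.PropositionalEquality.sym
                                            ; trans = Relation.Binary.PropositionalEquality.trans } }

Light : EqRel → Set
Light R = IdRel ≤c R

InfinitelyManyClasses : EqRel → Set
InfinitelyManyClasses R =
  ∀ n → Σ (Fin n → ℕ) λ a → ∀ i j → rel R (a i) (a j) → i ≡ j

FinitelyManyClasses : EqRel → Set
FinitelyManyClasses R =
  Σ ℕ λ n → Σ (Fin n → ℕ) λ a → ∀ x → ∃[ i ] rel R x (a i)

Dark : EqRel → Set
Dark R = ¬ Light R × InfinitelyManyClasses R

FinitelyMinimal : EqRel → Set₁
FinitelyMinimal R = ∀ (S : EqRel) → S <c R → FinitelyManyClasses S

CompClass : EqRel → ℕ → Set
CompClass R a = Σ (ℕ → ℕ) λ χ → Computable χ ×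
                  (∀ x → (rel R x a → χ x ≡ 1) × (¬ rel R x a → χ x ≡ 0))

HasComputableClass : EqRel → Set
HasComputableClass R = ∃[ a ] CompClass R a

-- Let χ decide the computable class [a], and pick b outside [a]. The computable map
-- σ x = (if χ x ≡ 0 then x else b) fixes every class except [a], which it sends into [b].
-- The pullback S of R along σ lies below R via σ and still has infinitely many classes.
-- If R ≤c S via h, then σ ∘ h is a self-reduction of R that avoids [a]; iterating it
-- from a enumerates pairwise inequivalent numbers, so R would be light.
module Submission where

open import Defs
open import Data.Nat using (ℕ; zero; suc)
open import Data.Nat.GeneralisedArithmetic using (fold)
open import Data.Nat.Properties using (n<1+n)
open import Data.Fin using (Fin) renaming (zero to fzero; suc to fsuc)
open import Data.Fin.Properties using (pigeonhole; <⇒≢; 0≢1+n)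
open import Data.Vec using (Vec; []; _∷_)
open import Data.Vec.Functional using () renaming (_∷_ to _◂_)
open import Data.Product using (∃-syntax; _×_; _,_; proj₁; proj₂)
open import Data.Sum using (_⊎_; inj₁; inj₂)
open import Data.Empty using (⊥-elim)
open import Function using (_∘_; id; const)
open import Relation.Nullary using (¬_)
open import Relation.Binary.PropositionalEquality using (_≡_; refl; cong; subst)
open import Relation.Binary.Structures using (IsEquivalence)

ifZero : ℕ → ℕ → ℕ → ℕ
ifZero zero    x _ = x
ifZero (suc _) _ y = y

constP : ∀ {n} → ℕ → PR n
constP zero    = zer
constP (suc k) = comp succ (constP k ∷ [])

constP↓ : ∀ {n} k {xs : Vec ℕ n} → constP k [ xs ]↓ k
constP↓ zero    = zer↓
constP↓ (suc k) = comp↓ (∷↓ (constP↓ k) []↓) succ↓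

Computable-id : Computable id
Computable-id = proj fzero , λ _ → proj↓

Computable-const : ∀ k → Computable (const k)
Computable-const k = constP k , λ _ → constP↓ k

Computable-∘ : ∀ {f g} → Computable f → Computable g → Computable (f ∘ g)
Computable-∘ {f} {g} (p , p↓) (q , q↓) =
  comp p (q ∷ []) , λ x → comp↓ (∷↓ (q↓ x) []↓) (p↓ (g x))

Computable-fold : ∀ {s} z → Computable s → Computable (fold z s)
Computable-fold {s} z (p , p↓) = prec (constP z) (comp p (proj (fsuc fzero) ∷ [])) , fold↓
  where
  fold↓ : ∀ n → prec (constP z) (comp p (proj (fsuc fzero) ∷ [])) [ n ∷ [] ]↓ fold z s n
  fold↓ zero    = prec0 (constP↓ z)
  fold↓ (suc n) = precS (fold↓ n) (comp↓ (∷↓ proj↓ []↓) (p↓ (fold z s n)))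

Computable-ifZero : ∀ {c f g} → Computable c → Computable f → Computable g →
                    Computable (λ x → ifZero (c x) (f x) (g x))
Computable-ifZero {c} {f} {g} (r , r↓) (p , p↓) (q , q↓) =
  comp cases (r ∷ proj fzero ∷ []) , λ x → comp↓ (∷↓ (r↓ x) (∷↓ proj↓ []↓)) (cases↓ (c x) x)
  where
  cases : PR 2
  cases = prec p (comp q (proj (fsuc (fsuc fzero)) ∷ []))

  cases↓ : ∀ k x → cases [ k ∷ x ∷ [] ]↓ ifZero k (f x) (g x)
  cases↓ zero    x = prec0 (p↓ x)
  cases↓ (suc k) x = precS (cases↓ k x) (comp↓ (∷↓ proj↓ []↓) (q↓ x))

≤c-trans : ∀ {R S T} → R ≤c S → S ≤c T → R ≤c T
≤c-trans (f , fc , f-red) (g , gc , g-red) =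
  g ∘ f , Computable-∘ gc fc , λ x y →
    proj₁ (g-red (f x) (f y)) ∘ proj₁ (f-red x y) , proj₂ (f-red x y) ∘ proj₂ (g-red (f x) (f y))

pullback : EqRel → (ℕ → ℕ) → EqRel
pullback R g = record
  { rel  = λ x y → rel R (g x) (g y)
  ; isEq = record { refl = R.refl ; sym = R.sym ; trans = R.trans }
  }
  where module R = IsEquivalence (isEq R)

pullback-≤c : ∀ R {g} → Computable g → pullback R g ≤c R
pullback-≤c R {g} gc = g , gc , λ _ _ → id , id

module _ (R : EqRel) where
  private module R = IsEquivalence (isEq R)

  avoiding-self-reduction⇒light : ∀ {a} ((f , _) : R ≤c R) → (∀ x → ¬ rel R (f x) a) → Light R
  avoiding-self-reduction⇒light {a} (f , fc , f-red) avoids =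
    fold a f , Computable-fold a fc , λ x y → (λ { refl → R.refl }) , injective x y
    where
    injective : ∀ x y → rel R (fold a f x) (fold a f y) → x ≡ y
    injective zero    zero    _ = refl
    injective zero    (suc y) r = ⊥-elim (avoids (fold a f y) (R.sym r))
    injective (suc x) zero    r = ⊥-elim (avoids (fold a f x) r)
    injective (suc x) (suc y) r = cong suc (injective x y (proj₂ (f-red _ _) r))

  ¬¬-covered⇒¬infinite : ∀ {n} (r : Fin n → ℕ) → (∀ x → ∃[ i ] ¬ ¬ rel R x (r i)) →
                         ¬ InfinitelyManyClasses R
  ¬¬-covered⇒¬infinite {n} r cover infinite
    with e , e-inj ← infinite (suc n)
    with i , j , i<j , same ← pigeonhole (n<1+n n) (proj₁ ∘ cover ∘ e) =
    i∈ λ ri → j∈ λ rj → <⇒≢ i<j (e-inj i j (R.trans ri (R.sym rj)))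
    where
    i∈ : ¬ ¬ rel R (e i) (r (proj₁ (cover (e j))))
    i∈ = subst (λ t → ¬ ¬ rel R (e i) (r t)) same (proj₂ (cover (e i)))
    j∈ : ¬ ¬ rel R (e j) (r (proj₁ (cover (e j))))
    j∈ = proj₂ (cover (e j))

  pullback-¬finite : ∀ {a g} → (∀ x → ¬ ¬ rel R x a ⊎ rel R (g x) x) →
                     InfinitelyManyClasses R → ¬ FinitelyManyClasses (pullback R g)
  pullback-¬finite {a} {g} fixes infinite (n , r , cover) =
    ¬¬-covered⇒¬infinite (a ◂ g ∘ r) cover′ infinite
    where
    cover′ : ∀ x → ∃[ i ] ¬ ¬ rel R x ((a ◂ g ∘ r) i)
    cover′ x with fixes x | cover x
    ... | inj₁ x∈a | _         = fzero , x∈a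
    ... | inj₂ gx≈x | i , gx≈gri = fsuc i , λ k → k (R.trans (R.sym gx≈x) gx≈gri)

  module _ {a : ℕ} {χ : ℕ → ℕ} (χ-char : ∀ x → (rel R x a → χ x ≡ 1) × (¬ rel R x a → χ x ≡ 0)) where

    χ≡0⇒∉ : ∀ {x} → χ x ≡ 0 → ¬ rel R x a
    χ≡0⇒∉ {x} χx≡0 x∈a with () ← subst (_≡ 1) χx≡0 (proj₁ (χ-char x) x∈a)

    χ≡suc⇒¬¬∈ : ∀ {x k} → χ x ≡ suc k → ¬ ¬ rel R x a
    χ≡suc⇒¬¬∈ {x} χx≡suc x∉a with () ← subst (_≡ 0) χx≡suc (proj₂ (χ-char x) x∉a)

    outside-class : InfinitelyManyClasses R → ∃[ b ] ¬ rel R b a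
    outside-class infinite
      with e , e-inj ← infinite 2
      with χ (e fzero) in χe₀ | χ (e (fsuc fzero)) in χe₁
    ... | zero  | _     = e fzero , χ≡0⇒∉ χe₀
    ... | suc _ | zero  = e (fsuc fzero) , χ≡0⇒∉ χe₁
    ... | suc _ | suc _ = ⊥-elim (χ≡suc⇒¬¬∈ χe₀ λ e₀∈a → χ≡suc⇒¬¬∈ χe₁ λ e₁∈a →
                            0≢1+n (e-inj fzero (fsuc fzero) (R.trans e₀∈a (R.sym e₁∈a))))

    collapse : ℕ → ℕ → ℕ
    collapse b x = ifZero (χ x) x b

    collapse-avoids : ∀ {b} → ¬ rel R b a → ∀ x → ¬ rel R (collapse b x) a
    collapse-avoids b∉a x with χ x in χx
    ... | zero  = χ≡0⇒∉ χx
    ... | suc _ = b∉a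

    collapse-fixes : ∀ b x → ¬ ¬ rel R x a ⊎ rel R (collapse b x) x
    collapse-fixes b x with χ x in χx
    ... | zero  = inj₂ R.refl
    ... | suc _ = inj₁ (χ≡suc⇒¬¬∈ χx)

lemma2p4 : (R : EqRel) → Dark R → HasComputableClass R → ¬ FinitelyMinimal R
lemma2p4 R (¬light , infinite) (a , χ , χc , χ-char) minimal
  with b , b∉a ← outside-class R χ-char infinite =
  pullback-¬finite R (collapse-fixes R χ-char b) infinite (minimal S (S≤R , R≰S))
  where
  S : EqRel
  S = pullback R (collapse R χ-char b)

  S≤R : S ≤c R
  S≤R = pullback-≤c R (Computable-ifZero χc Computable-id (Computable-const b))

  R≰S : ¬ R ≤c S
  R≰S R≤S@(h , _) = ¬light (avoiding-self-reduction⇒light R (≤c-trans {R} {S} {R} R≤S S≤R)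
                                                            (collapse-avoids R χ-char b∉a ∘ h))
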